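{- Let $D=(V,A)$ be a directed graph and let $R_D$ be an inclusion-wise minimal bad set of $D$. Let $D'=(V',A')$ where $V'=V\cup\{r_1,r_2\}$ with $r_1,r_2$ new vertices and $A'=A\cup\{(r_1,r_2)\}\cup\{(v,r_1),(r_2,v)\mid v\in R_D\}$. Then $n(D')=n(D)+2$, $f(D') = f(D)+1$, and $\{r_1,r_2\}$ is an inclusion-wise minimal bad set of $D'$.
   Context: Directed graphs are finite oriented graphs. A feedback vertex set is a set of vertices whose deletion leaves no directed cycle; $f(D)$ is the minimum size of a feedback vertex set and $n(D)$ the number of vertices. A set of vertices is bad if it is not contained in any minimum feedback vertex set; a bad set is inclusion-wise minimal if no proper subset of it is bad. -}

module Defs where

open import Data.Nat using (ℕ; zero; suc; _+_; _≤_)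
open import Data.Fin using (Fin; zero; suc)
open import Data.Vec using (lookup)
open import Relation.Binary.PropositionalEquality using (_≡_)
open import Data.Bool using (Bool; true; false; T)
open import Data.List using (List; []; _∷_)
open import Data.List.Relation.Unary.All using (All)
open import Data.List.Relation.Unary.Unique.Propositional using (Unique)
open import Data.Fin.Subset using (Subset; _∈_; _∉_; _⊆_; _⊂_; ∣_∣; ⁅_⁆; _∪_)
open import Data.Product using (_×_; ∃; ∃-syntax; Σ-syntax)
open import Relation.Nullary using (¬_)

Digraph : ℕ → Set
Digraph n = Fin n → Fin n → Bool

Arc : ∀ {n} → Digraph n → Fin n → Fin n → Set
Arc D u v = T (D u v)

Oriented : ∀ {n} → Digraph n → Set
Oriented {n} D = (∀ (v : Fin n) → ¬ Arc D v v) × (∀ (u v : Fin n) → Arc D u v → ¬ Arc D v u)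

nV : ∀ {n} → Digraph n → ℕ
nV {n} _ = n

ClosedChain : ∀ {n} → Digraph n → Fin n → Fin n → List (Fin n) → Set
ClosedChain D s v []       = Arc D v s
ClosedChain D s v (w ∷ ws) = Arc D v w × ClosedChain D s w ws

-- A directed cycle v → w₁ → … → wₖ → v on pairwise distinct vertices,
-- all lying outside the set S (i.e. a directed cycle of D - S).
CycleAvoiding : ∀ {n} → Digraph n → Subset n → Set
CycleAvoiding {n} D S =
  ∃[ v ] ∃[ ws ] (Unique (v ∷ ws) × ClosedChain D v v ws × All (_∉ S) (v ∷ ws))

IsFVS : ∀ {n} → Digraph n → Subset n → Set
IsFVS D S = ¬ CycleAvoiding D S

IsMinFVS : ∀ {n} → Digraph n → Subset n → Set
IsMinFVS {n} D S = IsFVS D S × (∀ (T : Subset n) → IsFVS D T → ∣ S ∣ ≤ ∣ T ∣)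

FVSNumber : ∀ {n} → Digraph n → ℕ → Set
FVSNumber {n} D k = ∃[ S ] (IsMinFVS D S × ∣ S ∣ ≡ k)

Bad : ∀ {n} → Digraph n → Subset n → Set
Bad {n} D X = ∀ (S : Subset n) → IsMinFVS D S → ¬ (X ⊆ S)

MinimalBad : ∀ {n} → Digraph n → Subset n → Set
MinimalBad {n} D X = Bad D X × (∀ (Y : Subset n) → Y ⊂ X → ¬ Bad D Y)

-- The construction D' on Fin (2 + n): r₁ = zero, r₂ = suc zero,
-- an old vertex v of D becomes suc (suc v).
r₁ r₂ : ∀ {n} → Fin (suc (suc n))
r₁ = zero
r₂ = suc zero

extend : ∀ {n} → Digraph n → Subset n → Digraph (suc (suc n))
extend D R zero          zero          = false
extend D R zero          (suc zero)    = true
extend D R zero          (suc (suc v)) = false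
extend D R (suc zero)    zero          = false
extend D R (suc zero)    (suc zero)    = false
extend D R (suc zero)    (suc (suc v)) = lookup R v
extend D R (suc (suc u)) zero          = lookup R u
extend D R (suc (suc u)) (suc zero)    = false
extend D R (suc (suc u)) (suc (suc v)) = D u v

old : ∀ {n} → Fin n → Fin (suc (suc n))
old v = suc (suc v)

R₁₂ : ∀ {n} → Subset (suc (suc n))
R₁₂ = ⁅ r₁ ⁆ ∪ ⁅ r₂ ⁆

{-# OPTIONS --safe #-}
-- Deleting r₁ also kills every cycle through r₂ (its only in-neighbour is r₁), and deleting r₂
-- kills every cycle through r₁ (its only out-neighbour is r₂); so S ∪ {r₁} and S ∪ {r₂} are
-- feedback vertex sets of D' for every minimum feedback vertex set S of D. Conversely a feedback
-- vertex set U of D' restricts to one of D; if U misses both r₁ and r₂, the triangles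
-- r₁ → r₂ → v → r₁ (v ∈ R) force R ⊆ U, and badness of R then forbids U from having only f(D)
-- elements. Hence f(D') = f(D) + 1, no minimum set contains both r₁ and r₂, but each of them lies
-- in one.
module Submission where

open import Defs
open import Data.Nat using (ℕ; suc; _+_; _≤_; s≤s; s≤s⁻¹)
open import Data.Nat.Properties using (+-comm; ≤-trans; _<?_; ≮⇒≥; 1+n≰n)
open import Data.Fin using (Fin; zero; suc)
open import Data.Fin.Properties using (suc-injective)
open import Data.Fin.Subset using (Subset; _∈_; _∉_; _⊆_; _⊂_; ∣_∣; ⊥; inside; outside)
open import Data.Fin.Subset.Properties using (x∈p∪q⁻; ∉⊥; _∈?_; ∣p∣≤∣x∷p∣)
open import Data.Vec using (_∷_; lookup)
open import Data.Vec.Properties using ([]=⇒lookup)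
open import Data.Vec.Base using (here; there)
open import Data.List using ([]; _∷_; map)
open import Data.List.Relation.Unary.All as All using (All; []; _∷_)
import Data.List.Relation.Unary.All.Properties as All
open import Data.List.Relation.Unary.Unique.Propositional using (Unique)
import Data.List.Relation.Unary.Unique.Propositional.Properties as Unique
open import Data.List.Relation.Unary.AllPairs using ([]; _∷_)
open import Data.Product using (_×_; _,_; proj₁; proj₂; ∃-syntax)
open import Data.Sum using ([_,_])
open import Data.Bool using (T)
open import Data.Unit using (tt)
open import Data.Empty using (⊥-elim)
open import Relation.Nullary using (¬_; yes; no)
open import Relation.Binary.PropositionalEquality using (_≡_; refl; sym; trans; cong; subst)

old∉R₁₂ : ∀ {n} (v : Fin n) → old v ∉ R₁₂
old∉R₁₂ v (there (there p)) = [ ∉⊥ , ∉⊥ ] (x∈p∪q⁻ ⊥ ⊥ p)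

old-injective : ∀ {n} {u v : Fin n} → old u ≡ old v → u ≡ v
old-injective e = suc-injective (suc-injective e)

module Extension {n} (D : Digraph n) (R : Subset n) where

  D' : Digraph (suc (suc n))
  D' = extend D R

  ClosedChain-old⁺ : ∀ s v ws → ClosedChain D s v ws → ClosedChain D' (old s) (old v) (map old ws)
  ClosedChain-old⁺ s v []       c       = c
  ClosedChain-old⁺ s v (w ∷ ws) (a , c) = a , ClosedChain-old⁺ s w ws c

  ClosedChain-old⁻ : ∀ s v ws → ClosedChain D' (old s) (old v) (map old ws) → ClosedChain D s v ws
  ClosedChain-old⁻ s v []       c       = c
  ClosedChain-old⁻ s v (w ∷ ws) (a , c) = a , ClosedChain-old⁻ s w ws c

  CycleAvoiding-old⁺ : ∀ x y U → CycleAvoiding D U → CycleAvoiding D' (x ∷ y ∷ U)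
  CycleAvoiding-old⁺ x y U (v , ws , u , c , a) =
    old v , map old ws , Unique.map⁺ old-injective u , ClosedChain-old⁺ v v ws c ,
    All.map⁺ (All.map (λ w∉U → λ { (there (there w∈U)) → w∉U w∈U }) a)

  CycleAvoiding-old⁻ : ∀ {x y U} v ws → Unique (old v ∷ map old ws) →
    ClosedChain D' (old v) (old v) (map old ws) → All (_∉ (x ∷ y ∷ U)) (old v ∷ map old ws) →
    CycleAvoiding D U
  CycleAvoiding-old⁻ v ws u c a =
    v , ws , Unique.map⁻ u , ClosedChain-old⁻ v v ws c ,
    All.map (λ w∉ w∈U → w∉ (there (there w∈U))) (All.map⁻ a)

  IsFVS-restrict : ∀ x y U → IsFVS D' (x ∷ y ∷ U) → IsFVS D U
  IsFVS-restrict x y U fvs cycle = fvs (CycleAvoiding-old⁺ x y U cycle)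

  chain-avoiding-r₁-is-old : ∀ {X} → r₁ ∈ X → ∀ s v ws →
    ClosedChain D' (old s) (old v) ws → All (_∉ X) ws → ∃[ ws' ] map old ws' ≡ ws
  chain-avoiding-r₁-is-old r₁∈X s v []                 c       a          = [] , refl
  chain-avoiding-r₁-is-old r₁∈X s v (zero ∷ ws)        c       (r₁∉X ∷ a) = ⊥-elim (r₁∉X r₁∈X)
  chain-avoiding-r₁-is-old r₁∈X s v (suc zero ∷ ws)    (() , c) a
  chain-avoiding-r₁-is-old r₁∈X s v (suc (suc w) ∷ ws) (_ , c)  (_ ∷ a)
    with ws' , refl ← chain-avoiding-r₁-is-old r₁∈X s w ws c a = w ∷ ws' , refl

  chain-avoiding-r₂-is-old : ∀ {X} → r₂ ∈ X → ∀ s v ws →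
    ClosedChain D' (old s) (old v) ws → All (_∉ X) ws → ∃[ ws' ] map old ws' ≡ ws
  chain-avoiding-r₂-is-old r₂∈X s v []                         c            a              = [] , refl
  chain-avoiding-r₂-is-old r₂∈X s v (suc zero ∷ ws)            c            (r₂∉X ∷ a)     = ⊥-elim (r₂∉X r₂∈X)
  chain-avoiding-r₂-is-old r₂∈X s v (zero ∷ [])                (_ , ())     a
  chain-avoiding-r₂-is-old r₂∈X s v (zero ∷ zero ∷ ws)         (_ , () , _) a
  chain-avoiding-r₂-is-old r₂∈X s v (zero ∷ suc zero ∷ ws)     c            (_ ∷ r₂∉X ∷ a) = ⊥-elim (r₂∉X r₂∈X)
  chain-avoiding-r₂-is-old r₂∈X s v (zero ∷ suc (suc w) ∷ ws)  (_ , () , _) a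
  chain-avoiding-r₂-is-old r₂∈X s v (suc (suc w) ∷ ws)         (_ , c)      (_ ∷ a)
    with ws' , refl ← chain-avoiding-r₂-is-old r₂∈X s w ws c a = w ∷ ws' , refl

  no-chain-old-to-r₂-avoiding-r₁ : ∀ {X} → r₁ ∈ X → ∀ v ws →
    ClosedChain D' r₂ (old v) ws → ¬ All (_∉ X) ws
  no-chain-old-to-r₂-avoiding-r₁ r₁∈X v []                 ()       a
  no-chain-old-to-r₂-avoiding-r₁ r₁∈X v (zero ∷ ws)        c        (r₁∉X ∷ a) = r₁∉X r₁∈X
  no-chain-old-to-r₂-avoiding-r₁ r₁∈X v (suc zero ∷ ws)    (() , c) a
  no-chain-old-to-r₂-avoiding-r₁ r₁∈X v (suc (suc w) ∷ ws) (_ , c)  (_ ∷ a) =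
    no-chain-old-to-r₂-avoiding-r₁ r₁∈X w ws c a

  no-cycle-at-r₁-avoiding-r₂ : ∀ {X} → r₂ ∈ X → ∀ ws → ClosedChain D' r₁ r₁ ws → ¬ All (_∉ X) ws
  no-cycle-at-r₁-avoiding-r₂ r₂∈X []                 ()
  no-cycle-at-r₁-avoiding-r₂ r₂∈X (zero ∷ ws)        (() , _)
  no-cycle-at-r₁-avoiding-r₂ r₂∈X (suc zero ∷ ws)    c        (r₂∉X ∷ a) = r₂∉X r₂∈X
  no-cycle-at-r₁-avoiding-r₂ r₂∈X (suc (suc w) ∷ ws) (() , _)

  IsFVS-with-r₁ : ∀ S → IsFVS D S → IsFVS D' (inside ∷ outside ∷ S)
  IsFVS-with-r₁ S fvs (zero , ws , u , c , r₁∉ ∷ a) = r₁∉ here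
  IsFVS-with-r₁ S fvs (suc zero , [] , u , () , a)
  IsFVS-with-r₁ S fvs (suc zero , zero ∷ ws , u , c , _ ∷ r₁∉ ∷ a) = r₁∉ here
  IsFVS-with-r₁ S fvs (suc zero , suc zero ∷ ws , u , (() , c) , a)
  IsFVS-with-r₁ S fvs (suc zero , suc (suc w) ∷ ws , u , (_ , c) , _ ∷ _ ∷ a) =
    no-chain-old-to-r₂-avoiding-r₁ here w ws c a
  IsFVS-with-r₁ S fvs (suc (suc v) , ws , u , c , a@(_ ∷ a′))
    with ws' , refl ← chain-avoiding-r₁-is-old here v v ws c a′ = fvs (CycleAvoiding-old⁻ v ws' u c a)

  IsFVS-with-r₂ : ∀ S → IsFVS D S → IsFVS D' (outside ∷ inside ∷ S)
  IsFVS-with-r₂ S fvs (zero , ws , u , c , _ ∷ a) = no-cycle-at-r₁-avoiding-r₂ (there here) ws c a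
  IsFVS-with-r₂ S fvs (suc zero , ws , u , c , r₂∉ ∷ a) = r₂∉ (there here)
  IsFVS-with-r₂ S fvs (suc (suc v) , ws , u , c , a@(_ ∷ a′))
    with ws' , refl ← chain-avoiding-r₂-is-old (there here) v v ws c a′ = fvs (CycleAvoiding-old⁻ v ws' u c a)

  triangle : ∀ {U v} → v ∈ R → v ∉ U → CycleAvoiding D' (outside ∷ outside ∷ U)
  triangle {v = v} v∈R v∉U =
    r₁ , r₂ ∷ old v ∷ [] ,
    ((λ ()) ∷ (λ ()) ∷ []) ∷ ((λ ()) ∷ []) ∷ [] ∷ [] ,
    (tt , arc , arc) ,
    (λ ()) ∷ (λ { (there ()) }) ∷ (λ { (there (there v∈U)) → v∉U v∈U }) ∷ []
    where
    arc : T (lookup R v)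
    arc = subst T (sym ([]=⇒lookup v∈R)) tt

  ⊆-of-FVS-avoiding-r₁r₂ : ∀ U → IsFVS D' (outside ∷ outside ∷ U) → R ⊆ U
  ⊆-of-FVS-avoiding-r₁r₂ U fvs {v} v∈R with v ∈? U
  ... | yes v∈U = v∈U
  ... | no  v∉U = ⊥-elim (fvs (triangle v∈R v∉U))

  module _ {S} (min : IsMinFVS D S) (bad : Bad D R) where

    IsFVS-size-lower : ∀ U → IsFVS D' U → suc ∣ S ∣ ≤ ∣ U ∣
    IsFVS-size-lower (inside ∷ y ∷ U) fvs =
      s≤s (≤-trans (proj₂ min U (IsFVS-restrict inside y U fvs)) (∣p∣≤∣x∷p∣ y U))
    IsFVS-size-lower (outside ∷ inside ∷ U) fvs = s≤s (proj₂ min U (IsFVS-restrict outside inside U fvs))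
    IsFVS-size-lower (outside ∷ outside ∷ U) fvs with ∣ S ∣ <? ∣ U ∣
    ... | yes S<U = S<U
    ... | no  S≮U = ⊥-elim (bad U minU (⊆-of-FVS-avoiding-r₁r₂ U fvs))
      where
      minU : IsMinFVS D U
      minU = IsFVS-restrict outside outside U fvs , λ T fvsT → ≤-trans (≮⇒≥ S≮U) (proj₂ min T fvsT)

    IsMinFVS-with-r₁ : IsMinFVS D' (inside ∷ outside ∷ S)
    IsMinFVS-with-r₁ = IsFVS-with-r₁ S (proj₁ min) , IsFVS-size-lower

    IsMinFVS-with-r₂ : IsMinFVS D' (outside ∷ inside ∷ S)
    IsMinFVS-with-r₂ = IsFVS-with-r₂ S (proj₁ min) , IsFVS-size-lower

    Bad-R₁₂ : Bad D' R₁₂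
    Bad-R₁₂ (x ∷ y ∷ U) (fvs , minU) R₁₂⊆
      with here ← R₁₂⊆ {r₁} here | there here ← R₁₂⊆ {r₂} (there here) =
      1+n≰n (≤-trans (s≤s⁻¹ (minU _ (proj₁ IsMinFVS-with-r₁)))
                     (proj₂ min U (IsFVS-restrict inside inside U fvs)))

    ⊂R₁₂-not-bad : ∀ Y → Y ⊂ R₁₂ → ¬ Bad D' Y
    ⊂R₁₂-not-bad Y (Y⊆ , zero , _ , r₁∉Y) badY = badY _ IsMinFVS-with-r₂ Y⊆S∪r₂
      where
      Y⊆S∪r₂ : Y ⊆ (outside ∷ inside ∷ S)
      Y⊆S∪r₂ {zero}        r₁∈Y = ⊥-elim (r₁∉Y r₁∈Y)
      Y⊆S∪r₂ {suc zero}    _    = there here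
      Y⊆S∪r₂ {suc (suc v)} v∈Y  = ⊥-elim (old∉R₁₂ v (Y⊆ v∈Y))
    ⊂R₁₂-not-bad Y (Y⊆ , suc zero , _ , r₂∉Y) badY = badY _ IsMinFVS-with-r₁ Y⊆S∪r₁
      where
      Y⊆S∪r₁ : Y ⊆ (inside ∷ outside ∷ S)
      Y⊆S∪r₁ {zero}        _    = here
      Y⊆S∪r₁ {suc zero}    r₂∈Y = ⊥-elim (r₂∉Y r₂∈Y)
      Y⊆S∪r₁ {suc (suc v)} v∈Y  = ⊥-elim (old∉R₁₂ v (Y⊆ v∈Y))
    ⊂R₁₂-not-bad Y (_ , suc (suc v) , v∈R₁₂ , _) = ⊥-elim (old∉R₁₂ v v∈R₁₂)

open Extension

lemma5p9 : ∀ {n} (D : Digraph n) (R : Subset n) → Oriented D → MinimalBad D R →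
    ∀ (k : ℕ) → FVSNumber D k →
    (nV (extend D R) ≡ nV D + 2) × FVSNumber (extend D R) (k + 1) × MinimalBad (extend D R) R₁₂
lemma5p9 {n} D R _ (bad , _) k (S , min , ∣S∣≡k) =
  +-comm 2 n ,
  (inside ∷ outside ∷ S , IsMinFVS-with-r₁ D R min bad , trans (cong suc ∣S∣≡k) (+-comm 1 k)) ,
  Bad-R₁₂ D R min bad , ⊂R₁₂-not-bad D R min bad
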